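{- Let $\mathbf A$ be a semi-Heyting algebra satisfying the Stone identity $x^*\vee x^{**}\approx1$. Then the following are equivalent: (i) $\mathbf A$ satisfies $(x^*\to x)^*\approx1$; (ii) $\mathbf A$ satisfies $x^*\to y^*\approx y^*\to x^*$.
   Context: A semi-Heyting algebra is an algebra $\langle A;\wedge,\vee,\to,0,1\rangle$ such that $\langle A;\wedge,\vee,0,1\rangle$ is a bounded lattice and the identities $x\wedge(x\to y)\approx x\wedge y$, $x\wedge(y\to z)\approx x\wedge((x\wedge y)\to(x\wedge z))$, $x\to x\approx1$ hold. Write $x^*:=x\to0$ and $x^{**}:=(x^*)^*$. -}

module Defs where

open import Level using (Level; suc; _⊔_)
open import Relation.Binary.Core using (Rel)
open import Algebra.Core using (Op₂)
open import Algebra.Definitions using (Identity; Zero)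
open import Algebra.Lattice.Structures using (IsLattice)

-- A semi-Heyting algebra ⟨A; ∧, ∨, →, 0, 1⟩ (Sankappanavar), over a setoid.
-- ≈ is a congruence for ∧, ∨ (from IsLattice) and ⇒ (so ≈ models equality of A).
record IsSemiHeytingAlgebra {a ℓ} {A : Set a} (_≈_ : Rel A ℓ)
         (_∧_ _∨_ _⇒_ : Op₂ A) (𝟘 𝟙 : A) : Set (a ⊔ ℓ) where
  field
    isLattice  : IsLattice _≈_ _∨_ _∧_
    ⇒-cong     : ∀ {x y u v} → x ≈ y → u ≈ v → (x ⇒ u) ≈ (y ⇒ v)
    ∨-identity : Identity _≈_ 𝟘 _∨_
    ∧-identity : Identity _≈_ 𝟙 _∧_
    sh1 : ∀ x y → (x ∧ (x ⇒ y)) ≈ (x ∧ y)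
    sh2 : ∀ x y z → (x ∧ (y ⇒ z)) ≈ (x ∧ ((x ∧ y) ⇒ (x ∧ z)))
    sh3 : ∀ x → (x ⇒ x) ≈ 𝟙

record SemiHeytingAlgebra (a ℓ : Level) : Set (suc (a ⊔ ℓ)) where
  infixr 5 _⇒_
  infixr 7 _∧_
  infixr 6 _∨_
  infix  4 _≈_
  field
    Carrier : Set a
    _≈_     : Rel Carrier ℓ
    _∧_     : Op₂ Carrier
    _∨_     : Op₂ Carrier
    _⇒_     : Op₂ Carrier
    𝟘       : Carrier
    𝟙       : Carrier
    isSemiHeytingAlgebra : IsSemiHeytingAlgebra _≈_ _∧_ _∨_ _⇒_ 𝟘 𝟙
  open IsSemiHeytingAlgebra isSemiHeytingAlgebra public

  _* : Carrier → Carrier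
  x * = x ⇒ 𝟘

  Stone : Set (a ⊔ ℓ)
  Stone = ∀ x → ((x *) ∨ ((x *) *)) ≈ 𝟙

  Identity-i : Set (a ⊔ ℓ)
  Identity-i = ∀ x → (((x *) ⇒ x) *) ≈ 𝟙

  Identity-ii : Set (a ⊔ ℓ)
  Identity-ii = ∀ x y → ((x *) ⇒ (y *)) ≈ ((y *) ⇒ (x *))

{-# OPTIONS --safe #-}
module Submission where

open import Defs
open import Level using (_⊔_)
open import Data.Product using (proj₁; proj₂)
open import Function.Bundles using (_⇔_; mk⇔; module Equivalence)
open import Algebra.Lattice.Bundles using (Lattice)
import Algebra.Lattice.Properties.Lattice as LatticeProperties
import Relation.Binary.Lattice as Order
import Relation.Binary.Lattice.Properties.MeetSemilattice as MeetSemilatticeProperties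
import Relation.Binary.Reasoning.PartialOrder as PosetReasoning
open import Relation.Binary.Bundles using (Poset)

-- Residuation, x ∧ y ≤ z iff x ≤ y ⇒ (y ∧ z), makes the lattice distributive, and sh2 makes
-- x * a pseudocomplement. Identity (i) amounts to 𝟘 ⇒ x ≤ x * for all x; (ii) at 𝟙 and x *
-- gives 𝟘 ⇒ x * * ≈ x * * *, hence this. Conversely, splitting along complemented p and q
-- yields p ⇒ q ≈ (p ∧ q) ∨ (p * ∧ q *), which is symmetric in p and q, and by the Stone
-- identity every x * is complemented.

module SemiHeytingAlgebraProperties {a ℓ} (A : SemiHeytingAlgebra a ℓ) where
  open SemiHeytingAlgebra A
  open import Algebra.Lattice.Structures _≈_ using (module IsLattice)
  open IsLattice isLattice

  lattice : Lattice a ℓ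
  lattice = record { isLattice = isLattice }

  open LatticeProperties lattice using (∧-idem; ∨-∧-orderTheoreticLattice)
  -- x ≤ y unfolds to x ≈ x ∧ y; several proofs below use this directly.
  open Order.Lattice ∨-∧-orderTheoreticLattice
    using (_≤_; poset; meetSemilattice; x≤x∨y; y≤x∨y; ∨-least; x∧y≤x; x∧y≤y; antisym)
  open MeetSemilatticeProperties meetSemilattice using (∧-monotonic)
  open PosetReasoning poset
  open Poset poset using () renaming (refl to ≤-refl)

  ∧-zeroʳ : ∀ x → x ∧ 𝟘 ≈ 𝟘
  ∧-zeroʳ x = begin-equality
    x ∧ 𝟘         ≈⟨ ∧-comm x 𝟘 ⟩
    𝟘 ∧ x         ≈⟨ ∧-congˡ (proj₁ ∨-identity x) ⟨
    𝟘 ∧ (𝟘 ∨ x)   ≈⟨ ∧-absorbs-∨ 𝟘 x ⟩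
    𝟘             ∎

  ∧≈𝟘-downclosed : ∀ {x y z} → x ≤ y → y ∧ z ≈ 𝟘 → x ∧ z ≈ 𝟘
  ∧≈𝟘-downclosed {x} {y} {z} x≤y y∧z≈𝟘 = begin-equality
    x ∧ z         ≈⟨ ∧-congʳ x≤y ⟩
    (x ∧ y) ∧ z   ≈⟨ ∧-assoc x y z ⟩
    x ∧ (y ∧ z)   ≈⟨ ∧-congˡ y∧z≈𝟘 ⟩
    x ∧ 𝟘         ≈⟨ ∧-zeroʳ x ⟩
    𝟘             ∎

  transpose-⇒ : ∀ {x y z} → x ∧ y ≤ z → x ≤ y ⇒ y ∧ z
  transpose-⇒ {x} {y} {z} x∧y≤z = sym (begin-equality
    x ∧ (y ⇒ y ∧ z)                  ≈⟨ sh2 x y (y ∧ z) ⟩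
    x ∧ (x ∧ y ⇒ x ∧ (y ∧ z))        ≈⟨ ∧-congˡ (⇒-cong refl (∧-assoc x y z)) ⟨
    x ∧ (x ∧ y ⇒ (x ∧ y) ∧ z)        ≈⟨ ∧-congˡ (⇒-cong refl x∧y≤z) ⟨
    x ∧ (x ∧ y ⇒ x ∧ y)              ≈⟨ ∧-congˡ (sh3 (x ∧ y)) ⟩
    x ∧ 𝟙                            ≈⟨ proj₂ ∧-identity x ⟩
    x                                ∎)

  transpose-∧ : ∀ {x y z} → x ≤ y ⇒ y ∧ z → x ∧ y ≤ z
  transpose-∧ {x} {y} {z} x≤y⇒y∧z = begin
    x ∧ y                  ≤⟨ ∧-monotonic x≤y⇒y∧z ≤-refl ⟩
    (y ⇒ y ∧ z) ∧ y        ≈⟨ ∧-comm (y ⇒ y ∧ z) y ⟩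
    y ∧ (y ⇒ y ∧ z)        ≈⟨ sh1 y (y ∧ z) ⟩
    y ∧ (y ∧ z)            ≤⟨ x∧y≤y y (y ∧ z) ⟩
    y ∧ z                  ≤⟨ x∧y≤y y z ⟩
    z                      ∎

  ∧-distribʳ-∨ : ∀ x y z → (y ∨ z) ∧ x ≈ (y ∧ x) ∨ (z ∧ x)
  ∧-distribʳ-∨ x y z = antisym
    (transpose-∧ (∨-least (transpose-⇒ (x≤x∨y (y ∧ x) (z ∧ x)))
                          (transpose-⇒ (y≤x∨y (y ∧ x) (z ∧ x)))))
    (∨-least (∧-monotonic (x≤x∨y y z) ≤-refl) (∧-monotonic (y≤x∨y y z) ≤-refl))

  ∧-⇒-disjoint : ∀ {x y} z → x ∧ y ≈ 𝟘 → x ∧ (y ⇒ z) ≈ x ∧ (𝟘 ⇒ x ∧ z)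
  ∧-⇒-disjoint {x} {y} z x∧y≈𝟘 = trans (sh2 x y z) (∧-congˡ (⇒-cong x∧y≈𝟘 refl))

  ∧≈𝟘⇒≤* : ∀ {x y} → x ∧ y ≈ 𝟘 → x ≤ y *
  ∧≈𝟘⇒≤* {x} {y} x∧y≈𝟘 = sym (begin-equality
    x ∧ y *           ≈⟨ ∧-⇒-disjoint 𝟘 x∧y≈𝟘 ⟩
    x ∧ (𝟘 ⇒ x ∧ 𝟘)   ≈⟨ ∧-congˡ (⇒-cong refl (∧-zeroʳ x)) ⟩
    x ∧ (𝟘 ⇒ 𝟘)       ≈⟨ ∧-congˡ (sh3 𝟘) ⟩
    x ∧ 𝟙             ≈⟨ proj₂ ∧-identity x ⟩
    x                 ∎)

  x∧x*≈𝟘 : ∀ x → x ∧ x * ≈ 𝟘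
  x∧x*≈𝟘 x = trans (sh1 x 𝟘) (∧-zeroʳ x)

  x*∧x≈𝟘 : ∀ x → x * ∧ x ≈ 𝟘
  x*∧x≈𝟘 x = trans (∧-comm (x *) x) (x∧x*≈𝟘 x)

  x≤x** : ∀ x → x ≤ x * *
  x≤x** x = ∧≈𝟘⇒≤* (x∧x*≈𝟘 x)

  𝟙*≈𝟘 : 𝟙 * ≈ 𝟘
  𝟙*≈𝟘 = trans (sym (proj₁ ∧-identity (𝟙 *))) (x∧x*≈𝟘 𝟙)

  *≈𝟙⇔≈𝟘 : ∀ x → x * ≈ 𝟙 ⇔ x ≈ 𝟘
  *≈𝟙⇔≈𝟘 x = mk⇔
    (λ x*≈𝟙 → trans (sym (proj₂ ∧-identity x)) (trans (∧-congˡ (sym x*≈𝟙)) (x∧x*≈𝟘 x)))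
    (λ x≈𝟘 → trans (⇒-cong x≈𝟘 refl) (sh3 𝟘))

  Complemented : Carrier → Set ℓ
  Complemented u = u ∨ u * ≈ 𝟙

  split-complemented : ∀ {u} → Complemented u → ∀ t → t ≈ (u ∧ t) ∨ (u * ∧ t)
  split-complemented {u} u∨u*≈𝟙 t = begin-equality
    t                     ≈⟨ proj₁ ∧-identity t ⟨
    𝟙 ∧ t                 ≈⟨ ∧-congʳ u∨u*≈𝟙 ⟨
    (u ∨ u *) ∧ t         ≈⟨ ∧-distribʳ-∨ t u (u *) ⟩
    (u ∧ t) ∨ (u * ∧ t)   ∎

  𝟘⇒-Disjoint : Set (a ⊔ ℓ)
  𝟘⇒-Disjoint = ∀ x → x ∧ (𝟘 ⇒ x) ≈ 𝟘

  *⇒≈𝟘⇔∧𝟘⇒≈𝟘 : ∀ x → x * ⇒ x ≈ 𝟘 ⇔ x ∧ (𝟘 ⇒ x) ≈ 𝟘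
  *⇒≈𝟘⇔∧𝟘⇒≈𝟘 x = mk⇔ to from
    where
    to : x * ⇒ x ≈ 𝟘 → x ∧ (𝟘 ⇒ x) ≈ 𝟘
    to x*⇒x≈𝟘 = begin-equality
      x ∧ (𝟘 ⇒ x)       ≈⟨ ∧-congˡ (⇒-cong refl (∧-idem x)) ⟨
      x ∧ (𝟘 ⇒ x ∧ x)   ≈⟨ ∧-⇒-disjoint x (x∧x*≈𝟘 x) ⟨
      x ∧ (x * ⇒ x)     ≈⟨ ∧-congˡ x*⇒x≈𝟘 ⟩
      x ∧ 𝟘             ≈⟨ ∧-zeroʳ x ⟩
      𝟘                 ∎

    from : x ∧ (𝟘 ⇒ x) ≈ 𝟘 → x * ⇒ x ≈ 𝟘
    from x∧𝟘⇒x≈𝟘 = begin-equality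
      x * ⇒ x                   ≈⟨ ∧≈𝟘⇒≤* x*⇒x∧x*≈𝟘 ⟩
      (x * ⇒ x) ∧ x * *         ≈⟨ ∧-comm (x * ⇒ x) (x * *) ⟩
      x * * ∧ (x * ⇒ x)         ≈⟨ ∧-⇒-disjoint x (x*∧x≈𝟘 (x *)) ⟩
      x * * ∧ (𝟘 ⇒ x * * ∧ x)   ≈⟨ ∧-congˡ (⇒-cong refl (trans (x≤x** x) (∧-comm x (x * *)))) ⟨
      x * * ∧ (𝟘 ⇒ x)           ≈⟨ ∧-comm (x * *) (𝟘 ⇒ x) ⟩
      (𝟘 ⇒ x) ∧ x * *           ≈⟨ ∧≈𝟘-downclosed 𝟘⇒x≤x* (x∧x*≈𝟘 (x *)) ⟩
      𝟘                         ∎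
      where
      x*⇒x∧x*≈𝟘 : (x * ⇒ x) ∧ x * ≈ 𝟘
      x*⇒x∧x*≈𝟘 = trans (∧-comm (x * ⇒ x) (x *)) (trans (sh1 (x *) x) (x*∧x≈𝟘 x))

      𝟘⇒x≤x* : 𝟘 ⇒ x ≤ x *
      𝟘⇒x≤x* = ∧≈𝟘⇒≤* (trans (∧-comm (𝟘 ⇒ x) x) x∧𝟘⇒x≈𝟘)

  identity-i⇔𝟘⇒-disjoint : Identity-i ⇔ 𝟘⇒-Disjoint
  identity-i⇔𝟘⇒-disjoint = mk⇔
    (λ i x → to (*⇒≈𝟘⇔∧𝟘⇒≈𝟘 x) (to (*≈𝟙⇔≈𝟘 (x * ⇒ x)) (i x)))
    (λ d x → from (*≈𝟙⇔≈𝟘 (x * ⇒ x)) (from (*⇒≈𝟘⇔∧𝟘⇒≈𝟘 x) (d x)))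
    where open Equivalence

  identity-ii⇒𝟘⇒-disjoint : Identity-ii → 𝟘⇒-Disjoint
  identity-ii⇒𝟘⇒-disjoint ii x = begin-equality
    x ∧ (𝟘 ⇒ x)           ≈⟨ ∧-congˡ (⇒-cong refl (x≤x** x)) ⟩
    x ∧ (𝟘 ⇒ x ∧ x * *)   ≈⟨ ∧-⇒-disjoint (x * *) (∧-zeroʳ x) ⟨
    x ∧ (𝟘 ⇒ x * *)       ≈⟨ ∧-congˡ (⇒-cong 𝟙*≈𝟘 refl) ⟨
    x ∧ (𝟙 * ⇒ x * *)     ≈⟨ ∧-congˡ (ii 𝟙 (x *)) ⟩
    x ∧ (x * * ⇒ 𝟙 *)     ≈⟨ ∧-congˡ (⇒-cong refl 𝟙*≈𝟘) ⟩
    x ∧ x * * *           ≈⟨ ∧≈𝟘-downclosed (x≤x** x) (x∧x*≈𝟘 (x * *)) ⟩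
    𝟘                     ∎

  complemented-⇒ : 𝟘⇒-Disjoint → ∀ {p q} → Complemented p → Complemented q →
                   p ⇒ q ≈ (p ∧ q) ∨ (p * ∧ q *)
  complemented-⇒ d {p} {q} p-complemented q-complemented = begin-equality
    c                                           ≈⟨ split-complemented p-complemented c ⟩
    (p ∧ c) ∨ (p * ∧ c)                         ≈⟨ ∨-cong (sh1 p q) (split-complemented q-complemented (p * ∧ c)) ⟩
    (p ∧ q) ∨ ((q ∧ p * ∧ c) ∨ (q * ∧ p * ∧ c))  ≈⟨ ∨-congˡ (∨-cong within-q within-q*) ⟩
    (p ∧ q) ∨ (𝟘 ∨ (p * ∧ q *))                 ≈⟨ ∨-congˡ (proj₁ ∨-identity (p * ∧ q *)) ⟩
    (p ∧ q) ∨ (p * ∧ q *)                       ∎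
    where
    c : Carrier
    c = p ⇒ q

    below-p* : ∀ r → r ∧ p * ∧ c ≈ (r ∧ p *) ∧ (𝟘 ⇒ (r ∧ p *) ∧ q)
    below-p* r = trans (sym (∧-assoc r (p *) c))
                       (∧-⇒-disjoint q (∧≈𝟘-downclosed (x∧y≤y r (p *)) (x*∧x≈𝟘 p)))

    within-q : q ∧ p * ∧ c ≈ 𝟘
    within-q = begin-equality
      q ∧ p * ∧ c                         ≈⟨ below-p* q ⟩
      (q ∧ p *) ∧ (𝟘 ⇒ (q ∧ p *) ∧ q)     ≈⟨ ∧-congˡ (⇒-cong refl (x∧y≤x q (p *))) ⟨
      (q ∧ p *) ∧ (𝟘 ⇒ q ∧ p *)           ≈⟨ d (q ∧ p *) ⟩
      𝟘                                   ∎

    within-q* : q * ∧ p * ∧ c ≈ p * ∧ q *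
    within-q* = begin-equality
      q * ∧ p * ∧ c                       ≈⟨ below-p* (q *) ⟩
      (q * ∧ p *) ∧ (𝟘 ⇒ (q * ∧ p *) ∧ q) ≈⟨ ∧-congˡ (⇒-cong refl q*∧p*∧q≈𝟘) ⟩
      (q * ∧ p *) ∧ (𝟘 ⇒ 𝟘)               ≈⟨ ∧-congˡ (sh3 𝟘) ⟩
      (q * ∧ p *) ∧ 𝟙                     ≈⟨ proj₂ ∧-identity (q * ∧ p *) ⟩
      q * ∧ p *                           ≈⟨ ∧-comm (q *) (p *) ⟩
      p * ∧ q *                           ∎
      where
      q*∧p*∧q≈𝟘 : (q * ∧ p *) ∧ q ≈ 𝟘
      q*∧p*∧q≈𝟘 = ∧≈𝟘-downclosed (x∧y≤x (q *) (p *)) (x*∧x≈𝟘 q)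

  stone∧𝟘⇒-disjoint⇒identity-ii : Stone → 𝟘⇒-Disjoint → Identity-ii
  stone∧𝟘⇒-disjoint⇒identity-ii stone d x y = begin-equality
    x * ⇒ y *                           ≈⟨ complemented-⇒ d (stone x) (stone y) ⟩
    (x * ∧ y *) ∨ (x * * ∧ y * *)       ≈⟨ ∨-cong (∧-comm (x *) (y *)) (∧-comm (x * *) (y * *)) ⟩
    (y * ∧ x *) ∨ (y * * ∧ x * *)       ≈⟨ complemented-⇒ d (stone y) (stone x) ⟨
    y * ⇒ x *                           ∎

corollary8p7 : ∀ {a ℓ} (A : SemiHeytingAlgebra a ℓ) →
    SemiHeytingAlgebra.Stone A →
    (SemiHeytingAlgebra.Identity-i A ⇔ SemiHeytingAlgebra.Identity-ii A)
corollary8p7 A stone = mk⇔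
  (λ i → stone∧𝟘⇒-disjoint⇒identity-ii stone (to identity-i⇔𝟘⇒-disjoint i))
  (λ ii → from identity-i⇔𝟘⇒-disjoint (identity-ii⇒𝟘⇒-disjoint ii))
  where
  open SemiHeytingAlgebraProperties A
  open Equivalence
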